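{- Let $\mathbf A=(A,\wedge,\vee,\cdot,\backslash,\slash)$ be a residuated binar (the lattice reduct is not assumed distributive). Then for each of the following pairs, $\mathbf A$ satisfies the first identity (for all values of its variables in $A$) if and only if it satisfies the second: \begin{enumerate} \item $x (y\wedge z) = x y\wedge x z$ and $xz\wedge yw\leq (x\vee y)(z\wedge w)$; \item $(x\wedge y) z = x z\wedge y z$ and $xz\wedge yw\leq (x\wedge y)(z\vee w)$; \item $x\backslash (y\vee z) = x\backslash y\vee x\backslash z$ and $(x\vee y)\backslash (z\vee w) \leq x\backslash z \vee y\backslash w$; \item $(x\vee y)\slash z = x\slash z\vee y\slash z$ and $(z\vee w)\slash (x\vee y) \leq z\slash x\vee w\slash y$; \item $(x\wedge y)\backslash z = x\backslash z\vee y\backslash z$ and $(x\wedge y)\backslash (z\wedge w)\leq x\backslash z\vee y\backslash w$; \item $x\slash (y\wedge z) = x\slash y\vee x\slash z$ and $(z\wedge w)\slash (x\wedge y)\leq z\slash x\vee w\slash y$. \end{enumerate}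
   Context: A residuated binar is an algebra $\mathbf A=(A,\wedge,\vee,\cdot,\backslash,\slash)$ where $(A,\wedge,\vee)$ is a lattice, $\cdot$ is a binary operation on $A$ (written $xy$), and for all $x,y,z\in A$: $x\cdot y\le z \iff x\le z\slash y \iff y\le x\backslash z$. Convention: $\cdot$ binds more tightly than $\backslash,\slash$, which bind more tightly than $\wedge,\vee$. -}

module Defs where

open import Level using (Level; _⊔_; suc)
open import Data.Product using (_×_)
open import Function.Bundles using (_⇔_)
open import Relation.Binary.Lattice.Bundles using (Lattice)

record ResiduatedBinar (c ℓ₁ ℓ₂ : Level) : Set (suc (c ⊔ ℓ₁ ⊔ ℓ₂)) where
  infixl 7 _·_
  infixr 6 _\\_
  infixl 6 _//_
  field
    lattice : Lattice c ℓ₁ ℓ₂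
  open Lattice lattice public
  field
    _·_  : Carrier → Carrier → Carrier
    _\\_ : Carrier → Carrier → Carrier
    _//_ : Carrier → Carrier → Carrier
    res-left  : ∀ x y z → (x · y ≤ z) ⇔ (x ≤ z // y)
    res-right : ∀ x y z → (x · y ≤ z) ⇔ (y ≤ x \\ z)

module Identities {c ℓ₁ ℓ₂} (A : ResiduatedBinar c ℓ₁ ℓ₂) where
  open ResiduatedBinar A

  L1a L2a L3a L4a L5a L6a : Set (c ⊔ ℓ₁)
  L1b L2b L3b L4b L5b L6b : Set (c ⊔ ℓ₂)
  L1a = ∀ x y z → x · (y ∧ z) ≈ (x · y) ∧ (x · z)
  L1b = ∀ x y z w → ((x · z) ∧ (y · w)) ≤ (x ∨ y) · (z ∧ w)
  L2a = ∀ x y z → (x ∧ y) · z ≈ (x · z) ∧ (y · z)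
  L2b = ∀ x y z w → ((x · z) ∧ (y · w)) ≤ (x ∧ y) · (z ∨ w)
  L3a = ∀ x y z → x \\ (y ∨ z) ≈ (x \\ y) ∨ (x \\ z)
  L3b = ∀ x y z w → (x ∨ y) \\ (z ∨ w) ≤ (x \\ z) ∨ (y \\ w)
  L4a = ∀ x y z → (x ∨ y) // z ≈ (x // z) ∨ (y // z)
  L4b = ∀ x y z w → (z ∨ w) // (x ∨ y) ≤ (z // x) ∨ (w // y)
  L5a = ∀ x y z → (x ∧ y) \\ z ≈ (x \\ z) ∨ (y \\ z)
  L5b = ∀ x y z w → (x ∧ y) \\ (z ∧ w) ≤ (x \\ z) ∨ (y \\ w)
  L6a = ∀ x y z → x // (y ∧ z) ≈ (x // y) ∨ (x // z)
  L6b = ∀ x y z w → (z ∧ w) // (x ∧ y) ≤ (z // x) ∨ (w // y)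

module Submission where

open import Defs
open import Level using (Level; _⊔_)
open import Data.Product using (_×_; _,_)
open import Function.Base using (flip)
open import Function.Bundles using (_⇔_; mk⇔; Equivalence)
import Function.Properties.Equivalence as ⇔
open import Relation.Binary.Core using (_Preserves₂_⟶_⟶_)
open import Relation.Binary.Lattice.Bundles using (Lattice)
open import Relation.Binary.Lattice.Properties.Lattice using (∧-∨-lattice)

-- Reading the order of A upside down in an argument where an operation is
-- antitone, and in the value where needed, makes ·, \\ and // monotone in both
-- arguments, and each pair becomes: f preserves meets in its second argument iff
-- f x z ∧ f y w ≤ f (x ∨ y) (z ∧ w).  Forward, f x z and f y w lie below
-- f (x ∨ y) z and f (x ∨ y) w, whose meet is f (x ∨ y) (z ∧ w); backward, the
-- case x = y gives f x y ∧ f x z ≤ f (x ∨ x) (y ∧ z) = f x (y ∧ z).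

module Interchange
  {a b c ℓ₁ ℓ₂ ℓ₃ ℓ₄ ℓ₅ ℓ₆ : Level}
  (L₁ : Lattice a ℓ₁ ℓ₂) (L₂ : Lattice b ℓ₃ ℓ₄) (L : Lattice c ℓ₅ ℓ₆)
  where

  open Lattice L₁ using () renaming (Carrier to X; _≤_ to _≤₁_; _∨_ to _∨₁_)
  open Lattice L₂ using () renaming (Carrier to Y; _≤_ to _≤₂_; _∧_ to _∧₂_)
  open Lattice L

  PreservesMeetʳ : (X → Y → Carrier) → Set (a ⊔ b ⊔ ℓ₅)
  PreservesMeetʳ f = ∀ x y z → f x (y ∧₂ z) ≈ f x y ∧ f x z

  MeetInterchange : (X → Y → Carrier) → Set (a ⊔ b ⊔ ℓ₆)
  MeetInterchange f = ∀ x y z w → f x z ∧ f y w ≤ f (x ∨₁ y) (z ∧₂ w)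

  preservesMeetʳ⇔meetInterchange : ∀ f → f Preserves₂ _≤₁_ ⟶ _≤₂_ ⟶ _≤_ →
                                   PreservesMeetʳ f ⇔ MeetInterchange f
  preservesMeetʳ⇔meetInterchange f f-mono = mk⇔ interchange distrib
    where
    open Lattice L₁ using () renaming (refl to refl₁; x≤x∨y to x≤₁x∨y; y≤x∨y to y≤₁x∨y)
    open Lattice L₂ using () renaming (refl to refl₂; x∧y≤x to x∧y≤₂x; x∧y≤y to x∧y≤₂y)

    interchange : PreservesMeetʳ f → MeetInterchange f
    interchange pres x y z w = trans
      (∧-greatest (trans (x∧y≤x _ _) (f-mono (x≤₁x∨y x y) refl₂))
                  (trans (x∧y≤y _ _) (f-mono (y≤₁x∨y x y) refl₂)))
      (reflexive (Eq.sym (pres (x ∨₁ y) z w)))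

    distrib : MeetInterchange f → PreservesMeetʳ f
    distrib inter x y z = antisym
      (∧-greatest (f-mono refl₁ (x∧y≤₂x y z)) (f-mono refl₁ (x∧y≤₂y y z)))
      (trans (inter x x y z) (f-mono (Lattice.∨-least L₁ refl₁ refl₁) refl₂))

module Monotonicity {c ℓ₁ ℓ₂ : Level} (A : ResiduatedBinar c ℓ₁ ℓ₂) where
  open ResiduatedBinar A
  open Equivalence using (to; from)

  ≤-//-unit : ∀ x y → x ≤ (x · y) // y
  ≤-//-unit x y = to (res-left x y (x · y)) refl

  ≤-\\-unit : ∀ x y → y ≤ x \\ (x · y)
  ≤-\\-unit x y = to (res-right x y (x · y)) refl

  //-counit : ∀ z y → (z // y) · y ≤ z
  //-counit z y = from (res-left (z // y) y z) refl

  \\-counit : ∀ x z → x · (x \\ z) ≤ z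
  \\-counit x z = from (res-right x (x \\ z) z) refl

  ·-monoˡ-≤ : ∀ {x x'} y → x ≤ x' → x · y ≤ x' · y
  ·-monoˡ-≤ {x' = x'} y x≤x' = from (res-left _ y _) (trans x≤x' (≤-//-unit x' y))

  ·-monoʳ-≤ : ∀ x {y y'} → y ≤ y' → x · y ≤ x · y'
  ·-monoʳ-≤ x {y' = y'} y≤y' = from (res-right x _ _) (trans y≤y' (≤-\\-unit x y'))

  ·-mono-≤ : _·_ Preserves₂ _≤_ ⟶ _≤_ ⟶ _≤_
  ·-mono-≤ {x} {x'} {y} x≤x' y≤y' = trans (·-monoˡ-≤ y x≤x') (·-monoʳ-≤ x' y≤y')

  \\-mono : _\\_ Preserves₂ flip _≤_ ⟶ _≤_ ⟶ _≤_
  \\-mono {x} {x'} {z} {z'} x'≤x z≤z' =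
    to (res-right x' (x \\ z) z') (trans (·-monoˡ-≤ (x \\ z) x'≤x) (trans (\\-counit x z) z≤z'))

  //-mono : _//_ Preserves₂ _≤_ ⟶ flip _≤_ ⟶ _≤_
  //-mono {z} {z'} {y} {y'} z≤z' y'≤y =
    to (res-left (z // y) y' z') (trans (·-monoʳ-≤ (z // y) y'≤y) (trans (//-counit z y) z≤z'))

lemma2p2 : ∀ {c ℓ₁ ℓ₂ : Level} (A : ResiduatedBinar c ℓ₁ ℓ₂) →
    let open Identities A in
    (L1a ⇔ L1b) × (L2a ⇔ L2b) × (L3a ⇔ L3b) ×
    (L4a ⇔ L4b) × (L5a ⇔ L5b) × (L6a ⇔ L6b)
lemma2p2 {c} {ℓ₁} {ℓ₂} A =
    interchange L L L _·_ ·-mono-≤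
  , ⇔.trans rotate (⇔.trans (interchange L L L (flip _·_) (λ p q → ·-mono-≤ q p)) swap)
  , interchange L Lᵒᵖ Lᵒᵖ _\\_ \\-mono
  , ⇔.trans rotate (interchange L Lᵒᵖ Lᵒᵖ (flip _//_) (λ p q → //-mono q p))
  , ⇔.trans rotate (⇔.trans (interchange Lᵒᵖ L Lᵒᵖ (flip _\\_) (λ p q → \\-mono q p)) swap)
  , ⇔.trans (interchange Lᵒᵖ L Lᵒᵖ _//_ //-mono) swap
  where
  open ResiduatedBinar A using (Carrier; _·_; _\\_; _//_) renaming (lattice to L)
  open Monotonicity A
  open Interchange using () renaming (preservesMeetʳ⇔meetInterchange to interchange)

  Lᵒᵖ : Lattice c ℓ₁ ℓ₂
  Lᵒᵖ = ∧-∨-lattice L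

  rotate : ∀ {ℓ} {P : Carrier → Carrier → Carrier → Set ℓ} →
           (∀ x y z → P z x y) ⇔ (∀ x y z → P x y z)
  rotate = mk⇔ (λ p x y z → p y z x) (λ p x y z → p z x y)

  swap : ∀ {ℓ} {Q : Carrier → Carrier → Carrier → Carrier → Set ℓ} →
         (∀ x y z w → Q x y z w) ⇔ (∀ x y z w → Q z w x y)
  swap = mk⇔ (λ q x y z w → q z w x y) (λ q x y z w → q z w x y)
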